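{- Every complement-connected graph $G$ with at least $5$ vertices has a vertex $v$ such that $G-v$ is complement-connected.
   Context: Graphs are finite and simple. A graph $G$ is complement-connected if both $G$ and its complement $\overline G$ are connected. $G-v$ denotes the graph obtained from $G$ by deleting the vertex $v$. -}

module Defs where

open import Data.Nat using (ℕ; suc; _≤_)
open import Data.Fin using (Fin; punchIn)
open import Data.Bool using (Bool; true; false; not)
open import Data.Product using (_×_)
open import Relation.Binary.PropositionalEquality using (_≡_; _≢_)
open import Relation.Binary.Construct.Closure.ReflexiveTransitive using (Star)
open import Relation.Nullary using (¬_)

record Graph (n : ℕ) : Set where
  field
    adj   : Fin n → Fin n → Bool
    adj-sym : ∀ u v → adj u v ≡ adj v u
    adj-irrefl : ∀ v → adj v v ≡ false

open Graph public

Edge : ∀ {n} → Graph n → Fin n → Fin n → Set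
Edge G u v = adj G u v ≡ true

Connected : ∀ {n} → Graph n → Set
Connected G = ∀ u v → Star (Edge G) u v

open import Data.Fin using (_≟_)
open import Relation.Nullary using (yes; no)

complement : ∀ {n} → Graph n → Graph n
complement {n} G = record { adj = a ; adj-sym = s ; adj-irrefl = i }
  where
  a : Fin n → Fin n → Bool
  a u v with u ≟ v
  ... | yes _ = false
  ... | no  _ = not (adj G u v)
  open import Relation.Binary.PropositionalEquality using (refl; cong; sym)
  s : ∀ u v → a u v ≡ a v u
  s u v with u ≟ v | v ≟ u
  ... | yes _ | yes _ = refl
  ... | yes p | no q = Data.Empty.⊥-elim (q (sym p))
    where import Data.Empty
  ... | no q | yes p = Data.Empty.⊥-elim (q (sym p))
    where import Data.Empty
  ... | no _ | no _ = cong not (Graph.adj-sym G u v)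
  i : ∀ v → a v v ≡ false
  i v with v ≟ v
  ... | yes _ = refl
  ... | no q = Data.Empty.⊥-elim (q refl)
    where import Data.Empty

ComplementConnected : ∀ {n} → Graph n → Set
ComplementConnected G = Connected G × Connected (complement G)

deleteVertex : ∀ {n} → Graph (suc n) → Fin (suc n) → Graph n
deleteVertex G v = record
  { adj = λ x y → adj G (punchIn v x) (punchIn v y)
  ; adj-sym = λ x y → Graph.adj-sym G (punchIn v x) (punchIn v y)
  ; adj-irrefl = λ x → Graph.adj-irrefl G (punchIn v x)
  }

-- Let K be the complement of H = G. If deleting vertex v = 0 leaves both connected
-- we are done; otherwise, up to swapping H and K, H - v has vertices x and y in
-- different components.
-- Let C be the component of x in H - v and D the rest of H - v. Every vertex of C
-- is K-adjacent to every vertex of D, so K - u is connected as soon as u spares a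
-- vertex of C, a vertex of D and a K-neighbour of v.
-- If v has two K-neighbours, pick e ∉ {v, x, y}. Every component of H - v contains
-- a non-cut vertex u of H; take it in the component of e. The side of e then keeps
-- e or its other known vertex (x or y), and the opposite side is untouched.
-- If w is the only K-neighbour of v, then v is H-adjacent to all other vertices and
-- H - u is connected for every u ∉ {v, w, z}, z an H-neighbour of w; with five
-- vertices u can moreover spare a vertex on each side.
module Submission where

open import Defs

open import Level using (Level; 0ℓ)
open import Function using (_∘_; id)
open import Function.Definitions using (Injective)
open import Data.Bool using (true; not)
import Data.Bool as Bool
open import Data.Bool.Properties using (not-involutive; ¬-not)
open import Data.Nat using (ℕ; zero; suc; _≤_; _<_; s≤s; z≤n)
open import Data.Nat.Properties using (<⇒≱; <-trans; ≤-refl)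
open import Data.Fin using (Fin; zero; suc; _≟_; punchIn; punchOut)
open import Data.Fin.Properties using (any?; all?; injective⇒≤; punchIn-injective; punchInᵢ≢i; punchIn-punchOut)
open import Data.Fin.Subset using (Subset; _∈_; _∉_; _⊆_; _⊂_; _─_; _-_; _∪_; ⁅_⁆; ⊤; inside)
open import Data.Fin.Subset.Properties using (∈⊤; _∈?_; x∈⁅x⁆; x∈⁅y⁆⇒x≡y; x∈p∧x≢y⇒x∈p-y; x∈p∧x∉q⇒x∈p─q; p─q⊆p; x∈p∪q⁺; x∈p∪q⁻)
open import Data.Fin.Subset.Induction using (⊂-wellFounded)
open import Data.List as List using (List; []; _∷_; length)
open import Data.List.Relation.Unary.All using (All; []; _∷_)
open import Data.List.Relation.Unary.All.Properties using (¬Any⇒All¬)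
open import Data.List.Relation.Unary.Any as Any using (Any; index)
open import Data.List.Relation.Unary.Any.Properties using (lookup-index)
open import Data.Product using (∃; _×_; _,_; proj₂; map₂; swap)
open import Data.Sum using (_⊎_; inj₁; inj₂)
open import Data.Unit.Polymorphic using (tt) renaming (⊤ to Unit)
open import Data.Vec using (_∷_; tabulate; here; there)
open import Data.Vec.Properties using (lookup⇒[]=; []=⇒lookup; lookup∘tabulate)
open import Induction.WellFounded using (Acc; acc)
open import Relation.Binary using (Rel; Decidable)
open import Relation.Binary.Construct.Closure.ReflexiveTransitive using (Star; ε; _◅_; _◅◅_; gmap; reverse)
open import Relation.Binary.PropositionalEquality using (_≡_; _≢_; refl; sym; trans; cong; subst; ≢-sym; module ≡-Reasoning)
open import Relation.Nullary using (Dec; does; yes; no; ¬_; ¬?; contradiction)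
open import Relation.Nullary.Decidable using (map′; _×-dec_; _⊎-dec_; _→-dec_; decidable-stable; dec-true)
open import Relation.Unary using (Pred)
import Relation.Unary as U

private
  variable
    ℓ : Level
    n : ℕ
    p : Subset n
    x y : Fin n

-- Through i j describes the R-walks from i to j, split at their first and last
-- visits to zero; the R₊-walks in between avoid zero. This decides Star R by
-- recursion on the number of vertices.
module ThroughZero {n} (R : Rel (Fin (suc n)) ℓ) where

  R₊ : Rel (Fin n) ℓ
  R₊ i j = R (suc i) (suc j)

  Through : Rel (Fin (suc n)) ℓ
  Through zero    zero    = Unit
  Through zero    (suc j) = ∃ λ b → R zero (suc b) × Star R₊ b j
  Through (suc i) zero    = ∃ λ a → Star R₊ i a × R (suc a) zero
  Through (suc i) (suc j) = Star R₊ i j ⊎ (Through (suc i) zero × Through zero (suc j))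

  lift : ∀ {i j} → Star R₊ i j → Star R (suc i) (suc j)
  lift = gmap suc id

  through⇒star : ∀ i j → Through i j → Star R i j
  through⇒star zero    zero    _                = ε
  through⇒star zero    (suc j) (b , r , p)      = r ◅ lift p
  through⇒star (suc i) zero    (a , p , r)      = lift p ◅◅ r ◅ ε
  through⇒star (suc i) (suc j) (inj₁ p)         = lift p
  through⇒star (suc i) (suc j) (inj₂ (t₁ , t₂)) = through⇒star (suc i) zero t₁ ◅◅ through⇒star zero (suc j) t₂

  through-refl : ∀ i → Through i i
  through-refl zero    = tt
  through-refl (suc i) = inj₁ ε

  through-step : ∀ i j k → Through i j → R j k → Through i k
  through-step zero    zero    zero    _                       _ = tt
  through-step zero    zero    (suc k) _                       r = k , r , ε
  through-step zero    (suc j) zero    _                       _ = tt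
  through-step zero    (suc j) (suc k) (b , r₀ , p)            r = b , r₀ , p ◅◅ r ◅ ε
  through-step (suc i) zero    zero    t                       _ = t
  through-step (suc i) zero    (suc k) t                       r = inj₂ (t , (k , r , ε))
  through-step (suc i) (suc j) zero    (inj₁ p)                r = j , p , r
  through-step (suc i) (suc j) zero    (inj₂ (t , _))          _ = t
  through-step (suc i) (suc j) (suc k) (inj₁ p)                r = inj₁ (p ◅◅ r ◅ ε)
  through-step (suc i) (suc j) (suc k) (inj₂ (t , b , r₀ , p)) r = inj₂ (t , b , r₀ , p ◅◅ r ◅ ε)

  star⇒through : ∀ {i j} → Star R i j → Through i j
  star⇒through {i} = go (through-refl i)
    where
    go : ∀ {j k} → Through i j → Star R j k → Through i k
    go t ε                  = t
    go t (_◅_ {j = j′} r p) = go (through-step i _ j′ t r) p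

  through? : Decidable R → Decidable (Star R₊) → Decidable Through
  through? R? star₊? zero    zero    = yes tt
  through? R? star₊? zero    (suc j) = any? λ b → R? zero (suc b) ×-dec star₊? b j
  through? R? star₊? (suc i) zero    = any? λ a → star₊? i a ×-dec R? (suc a) zero
  through? R? star₊? (suc i) (suc j) =
    star₊? i j ⊎-dec (through? R? star₊? (suc i) zero ×-dec through? R? star₊? zero (suc j))

star? : ∀ {n} {R : Rel (Fin n) ℓ} → Decidable R → Decidable (Star R)
star? {n = zero}  _  ()
star? {n = suc n} {R = R} R? i j =
  map′ (through⇒star i j) star⇒through (through? R? (star? (λ a b → R? (suc a) (suc b))) i j)
  where open ThroughZero R

∃-≢-all : (xs : List (Fin n)) → length xs < n → ∃ λ e → All (_≢ e) xs
∃-≢-all xs |xs|<n with any? (λ e → ¬? (Any.any? (_≟ e) xs))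
... | yes (e , e∉xs) = e , ¬Any⇒All¬ xs e∉xs
... | no ¬∃∉ = contradiction (injective⇒≤ index-injective) (<⇒≱ |xs|<n)
  where
  ∈xs : ∀ e → Any (_≡ e) xs
  ∈xs e = decidable-stable (Any.any? (_≟ e) xs) (¬∃∉ ∘ (e ,_))
  index-injective : Injective _≡_ _≡_ (λ e → index (∈xs e))
  index-injective {a} {b} eq =
    trans (sym (lookup-index (∈xs a))) (trans (cong (List.lookup xs) eq) (lookup-index (∈xs b)))

∃-≢-of-two : {P : Pred (Fin n) ℓ} → x ≢ y → P x → P y → ∀ u → ∃ λ t → P t × t ≢ u
∃-≢-of-two {x = x} x≢y px py u with x ≟ u
... | yes refl = _ , py , x≢y ∘ sym
... | no  x≢u = x , px , x≢u

x∈p─q⇒x∉q : ∀ {q} → x ∈ p ─ q → x ∉ q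
x∈p─q⇒x∉q {p = _ ∷ _} {inside ∷ _} ()        here
x∈p─q⇒x∉q {p = _ ∷ _} {_ ∷ _}      (there x∈) (there x∈q) = x∈p─q⇒x∉q x∈ x∈q

x∈p-y⇒x∈p : x ∈ p - y → x ∈ p
x∈p-y⇒x∈p {p = p} {y = y} = p─q⊆p p ⁅ y ⁆

x∈p-y⇒x≢y : x ∈ p - y → x ≢ y
x∈p-y⇒x≢y x∈ refl = x∈p─q⇒x∉q x∈ (x∈⁅x⁆ _)

x∈p∧y∉p⇒x≢y : x ∈ p → y ∉ p → x ≢ y
x∈p∧y∉p⇒x≢y x∈p y∉p refl = y∉p x∈p

x≢y⇒x∈⊤-y : x ≢ y → x ∈ ⊤ - y
x≢y⇒x∈⊤-y = x∈p∧x≢y⇒x∈p-y ∈⊤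

fromDecidable : {P : Pred (Fin n) ℓ} → U.Decidable P → Subset n
fromDecidable P? = tabulate (λ x → does (P? x))

module _ {P : Pred (Fin n) ℓ} (P? : U.Decidable P) where

  ∈-fromDecidable⁺ : P x → x ∈ fromDecidable P?
  ∈-fromDecidable⁺ {x = x} px = lookup⇒[]= x _ (trans (lookup∘tabulate _ x) (dec-true (P? x) px))

  ∈-fromDecidable⁻ : x ∈ fromDecidable P? → P x
  ∈-fromDecidable⁻ {x = x} x∈ with P? x | trans (sym (lookup∘tabulate _ x)) ([]=⇒lookup x∈)
  ... | yes px | _ = px
  ... | no _   | ()

-- A record rather than a Σ-type, so that G and W can be inferred from a walk.
record EdgeIn (G : Graph n) (W : Subset n) (u v : Fin n) : Set where
  constructor edgeIn
  field
    source∈ : u ∈ W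
    target∈ : v ∈ W
    edge    : Edge G u v

Walk : Graph n → Subset n → Rel (Fin n) 0ℓ
Walk G W = Star (EdgeIn G W)

ConnectedOn : Graph n → Subset n → Set
ConnectedOn G W = ∀ u v → u ∈ W → v ∈ W → Walk G W u v

module _ (G : Graph n) where

  edge-sym : Edge G x y → Edge G y x
  edge-sym {x = x} {y} e = trans (adj-sym G y x) e

  edge⇒≢ : Edge G x y → x ≢ y
  edge⇒≢ {x = x} e refl with () ← trans (sym e) (adj-irrefl G x)

module _ {G : Graph n} where

  ∃-neighbour : ConnectedOn G ⊤ → x ≢ y → ∃ (Edge G x)
  ∃-neighbour {x = x} {y} conn x≢y with conn x y ∈⊤ ∈⊤
  ... | ε                  = contradiction refl x≢y
  ... | edgeIn _ _ e ◅ _ = _ , e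

  module _ {W : Subset n} where

    edge⇒walk : x ∈ W → y ∈ W → Edge G x y → Walk G W x y
    edge⇒walk x∈ y∈ e = edgeIn x∈ y∈ e ◅ ε

    walk-sym : Walk G W x y → Walk G W y x
    walk-sym = reverse λ (edgeIn x∈ y∈ e) → edgeIn y∈ x∈ (edge-sym G e)

    walk-∈ : x ∈ W → Walk G W x y → y ∈ W
    walk-∈ x∈ ε                   = x∈
    walk-∈ _  (edgeIn _ y∈ _ ◅ w) = walk-∈ y∈ w

    walk-mono : ∀ {W′} → W ⊆ W′ → Walk G W x y → Walk G W′ x y
    walk-mono W⊆W′ = gmap id λ (edgeIn x∈ y∈ e) → edgeIn (W⊆W′ x∈) (W⊆W′ y∈) e

    hub⇒connectedOn : ∀ h → (∀ t → t ∈ W → Walk G W t h) → ConnectedOn G W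
    hub⇒connectedOn h to-h a b a∈ b∈ = to-h a a∈ ◅◅ walk-sym (to-h b b∈)

    walk? : Decidable (Walk G W)
    walk? = star? λ a b → map′ (λ (a∈ , b∈ , e) → edgeIn a∈ b∈ e) (λ (edgeIn a∈ b∈ e) → a∈ , b∈ , e)
      ((a ∈? W) ×-dec (b ∈? W) ×-dec (adj G a b Bool.≟ true))

    connectedOn? : Dec (ConnectedOn G W)
    connectedOn? = all? λ a → all? λ b → (a ∈? W) →-dec (b ∈? W) →-dec walk? a b

    ¬connectedOn⇒unreachable : ¬ ConnectedOn G W → ∀ r → ∃ λ t → t ∈ W × ¬ Walk G W r t
    ¬connectedOn⇒unreachable ¬conn r with any? (λ t → (t ∈? W) ×-dec ¬? (walk? r t))
    ... | yes unreachable = unreachable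
    ... | no ¬unreachable = contradiction (hub⇒connectedOn r to-r) ¬conn
      where
      to-r : ∀ t → t ∈ W → Walk G W t r
      to-r t t∈ = walk-sym (decidable-stable (walk? r t) λ ¬w → ¬unreachable (t , t∈ , ¬w))

component : Graph n → Subset n → Fin n → Subset n
component G W x = fromDecidable (walk? {G = G} {W} x)

module _ {G : Graph n} {W : Subset n} where

  ∈-component⁺ : Walk G W x y → y ∈ component G W x
  ∈-component⁺ {x = x} = ∈-fromDecidable⁺ (walk? x)

  ∈-component⁻ : y ∈ component G W x → Walk G W x y
  ∈-component⁻ {x = x} = ∈-fromDecidable⁻ (walk? x)

NonCutBesides : Graph n → Subset n → Fin n → Set
NonCutBesides G W r = ∃ λ u → u ∈ W - r × ConnectedOn G (W - u)

module Component {G : Graph n} {W : Subset n} {x y : Fin n}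
  (conn : ConnectedOn G W) (x∈W : x ∈ W) (y∈W-x : y ∈ W - x) where

  C : Subset n
  C = component G (W - x) y

  C⁺ : Subset n
  C⁺ = C ∪ ⁅ x ⁆

  C⊆W-x : C ⊆ W - x
  C⊆W-x t∈C = walk-∈ y∈W-x (∈-component⁻ t∈C)

  C⊆C⁺ : C ⊆ C⁺
  C⊆C⁺ t∈C = x∈p∪q⁺ (inj₁ t∈C)

  x∈C⁺ : x ∈ C⁺
  x∈C⁺ = x∈p∪q⁺ (inj₂ (x∈⁅x⁆ x))

  ∈C⁺⁻ : ∀ {t} → t ∈ C⁺ → t ∈ C ⊎ t ≡ x
  ∈C⁺⁻ t∈C⁺ with x∈p∪q⁻ C ⁅ x ⁆ t∈C⁺
  ... | inj₁ t∈C  = inj₁ t∈C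
  ... | inj₂ t∈⁅x⁆ = inj₂ (x∈⁅y⁆⇒x≡y x t∈⁅x⁆)

  C⁺⊆W : C⁺ ⊆ W
  C⁺⊆W t∈C⁺ with ∈C⁺⁻ t∈C⁺
  ... | inj₁ t∈C = x∈p-y⇒x∈p (C⊆W-x t∈C)
  ... | inj₂ refl = x∈W

  y∈C⁺-x : y ∈ C⁺ - x
  y∈C⁺-x = x∈p∧x≢y⇒x∈p-y (C⊆C⁺ (∈-component⁺ ε)) (x∈p-y⇒x≢y y∈W-x)

  leave : ∀ {t s} → t ∈ C → EdgeIn G W t s → s ∈ C ⊎ s ≡ x
  leave {s = s} t∈C (edgeIn _ s∈W e) with s ≟ x
  ... | yes s≡x = inj₂ s≡x
  ... | no  s≢x = inj₁ (∈-component⁺ (∈-component⁻ t∈C ◅◅ edge⇒walk (C⊆W-x t∈C) s∈W-x e))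
    where
    s∈W-x : s ∈ W - x
    s∈W-x = x∈p∧x≢y⇒x∈p-y s∈W s≢x

  walk-inside : ∀ {t} → t ∈ C → Walk G W t x → Walk G C⁺ t x
  walk-inside t∈C ε = ε
  walk-inside t∈C (step@(edgeIn _ _ e) ◅ w) with leave t∈C step
  ... | inj₁ s∈C = edgeIn (C⊆C⁺ t∈C) (C⊆C⁺ s∈C) e ◅ walk-inside s∈C w
  ... | inj₂ refl = edgeIn (C⊆C⁺ t∈C) x∈C⁺ e ◅ ε

  walk-outside : ∀ {t} → t ∉ C → Walk G W t x → Walk G (W ─ C) t x
  walk-outside t∉C ε = ε
  walk-outside {t} t∉C (edgeIn t∈W s∈W e ◅ w) with t ≟ x
  ... | yes refl = ε
  ... | no  t≢x with _ ∈? C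
  ...   | no s∉C = edgeIn (x∈p∧x∉q⇒x∈p─q t∈W t∉C) (x∈p∧x∉q⇒x∈p─q s∈W s∉C) e ◅ walk-outside s∉C w
  ...   | yes s∈C with leave s∈C (edgeIn s∈W t∈W (edge-sym G e))
  ...     | inj₁ t∈C = contradiction t∈C t∉C
  ...     | inj₂ t≡x = contradiction t≡x t≢x

  C⁺-connected : ConnectedOn G C⁺
  C⁺-connected = hub⇒connectedOn x to-x
    where
    to-x : ∀ t → t ∈ C⁺ → Walk G C⁺ t x
    to-x t t∈C⁺ with ∈C⁺⁻ t∈C⁺
    ... | inj₁ t∈C = walk-inside t∈C (conn t x (C⁺⊆W t∈C⁺) x∈W)
    ... | inj₂ refl = ε

  lift-nonCut : NonCutBesides G C⁺ x → ∃ λ u → u ∈ C × ConnectedOn G (W - u)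
  lift-nonCut (u , u∈C⁺-x , conn′) = u , u∈C , hub⇒connectedOn x to-x
    where
    u∈C : u ∈ C
    u∈C with ∈C⁺⁻ (x∈p-y⇒x∈p u∈C⁺-x)
    ... | inj₁ u∈C = u∈C
    ... | inj₂ u≡x = contradiction u≡x (x∈p-y⇒x≢y u∈C⁺-x)
    x∈W-u : x ∈ W - u
    x∈W-u = x∈p∧x≢y⇒x∈p-y x∈W λ x≡u → x∈p-y⇒x≢y (C⊆W-x u∈C) (sym x≡u)
    C⁺-u⊆W-u : C⁺ - u ⊆ W - u
    C⁺-u⊆W-u t∈ = x∈p∧x≢y⇒x∈p-y (C⁺⊆W (x∈p-y⇒x∈p t∈)) (x∈p-y⇒x≢y t∈)
    W─C⊆W-u : W ─ C ⊆ W - u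
    W─C⊆W-u t∈ = x∈p∧x≢y⇒x∈p-y (p─q⊆p W C t∈) (x∈p∧y∉p⇒x≢y u∈C (x∈p─q⇒x∉q t∈) ∘ sym)
    to-x : ∀ t → t ∈ W - u → Walk G (W - u) t x
    to-x t t∈W-u with t ∈? C
    ... | yes t∈C = walk-mono C⁺-u⊆W-u (conn′ t x t∈C⁺-u x∈C⁺-u)
      where
      t∈C⁺-u : t ∈ C⁺ - u
      t∈C⁺-u = x∈p∧x≢y⇒x∈p-y (C⊆C⁺ t∈C) (x∈p-y⇒x≢y t∈W-u)
      x∈C⁺-u : x ∈ C⁺ - u
      x∈C⁺-u = x∈p∧x≢y⇒x∈p-y x∈C⁺ (x∈p-y⇒x≢y x∈W-u)
    ... | no  t∉C = walk-mono W─C⊆W-u (walk-outside t∉C (conn t x (x∈p-y⇒x∈p t∈W-u) x∈W))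

module _ {G : Graph n} where

  -- If W - x is disconnected, some y is cut off from r in W - x. The component of
  -- y plus x is connected, misses r, and a non-cut vertex of it other than x is a
  -- non-cut vertex of W.
  nonCut-acc : ∀ {W r x} → Acc _⊂_ W → ConnectedOn G W → r ∈ W → x ∈ W - r → NonCutBesides G W r
  nonCut-acc {W = W} {r} {x} (acc rec) conn r∈W x∈W-r with connectedOn? {G = G} {W - x}
  ... | yes conn-x = x , x∈W-r , conn-x
  ... | no ¬conn-x with ¬connectedOn⇒unreachable ¬conn-x r
  ... | y , y∈W-x , ¬r⇝y =
    let u , u∈C , conn-u = lift-nonCut (nonCut-acc (rec C⁺⊂W) C⁺-connected x∈C⁺ y∈C⁺-x)
    in u , x∈p∧x≢y⇒x∈p-y (C⁺⊆W (C⊆C⁺ u∈C)) (x∈p∧y∉p⇒x≢y u∈C r∉C) , conn-u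
    where
    open Component conn (x∈p-y⇒x∈p x∈W-r) y∈W-x
    r∉C : r ∉ C
    r∉C r∈C = ¬r⇝y (walk-sym (∈-component⁻ r∈C))
    r∉C⁺ : r ∉ C⁺
    r∉C⁺ r∈C⁺ with ∈C⁺⁻ r∈C⁺
    ... | inj₁ r∈C  = r∉C r∈C
    ... | inj₂ r≡x = x∈p-y⇒x≢y x∈W-r (sym r≡x)
    C⁺⊂W : C⁺ ⊂ W
    C⁺⊂W = C⁺⊆W , r , r∈W , r∉C⁺

  nonCut : ∀ {W r x} → ConnectedOn G W → r ∈ W → x ∈ W - r → NonCutBesides G W r
  nonCut = nonCut-acc (⊂-wellFounded _)

  component-nonCut : ∀ {W x y} → ConnectedOn G W → x ∈ W → y ∈ W - x →
                     ∃ λ u → u ∈ component G (W - x) y × ConnectedOn G (W - u)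
  component-nonCut conn x∈W y∈W-x = lift-nonCut (nonCut C⁺-connected x∈C⁺ y∈C⁺-x)
    where open Component conn x∈W y∈W-x

-- A record so that H and K can be inferred from a proof.
record Complementary (H K : Graph n) : Set where
  constructor mkComplementary
  field
    adj≡not-adj : ∀ {u v} → u ≢ v → adj K u v ≡ not (adj H u v)

complement-adj : (G : Graph n) → ∀ {u v} → u ≢ v → adj (complement G) u v ≡ not (adj G u v)
complement-adj G {u} {v} u≢v with u ≟ v
... | yes u≡v = contradiction u≡v u≢v
... | no  _   = refl

module _ {H K : Graph n} (compl : Complementary H K) where

  open Complementary compl

  complementary-sym : Complementary K H
  complementary-sym = mkComplementary λ {u} {v} u≢v →
    trans (sym (not-involutive (adj H u v))) (cong not (sym (adj≡not-adj u≢v)))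

  complementary-edge⁺ : x ≢ y → ¬ Edge H x y → Edge K x y
  complementary-edge⁺ x≢y ¬e = trans (adj≡not-adj x≢y) (cong not (¬-not ¬e))

  complementary-edge⁻ : Edge K x y → ¬ Edge H x y
  complementary-edge⁻ e e′ with () ← trans (sym (cong not e′)) (trans (sym (adj≡not-adj (edge⇒≢ K e))) e)

Deletable : Graph n → Graph n → Fin n → Set
Deletable H K u = ConnectedOn H (⊤ - u) × ConnectedOn K (⊤ - u)

edge⇒walk-avoiding : ∀ {G : Graph n} {u} → x ≢ u → y ≢ u → Edge G x y → Walk G (⊤ - u) x y
edge⇒walk-avoiding x≢u y≢u = edge⇒walk (x≢y⇒x∈⊤-y x≢u) (x≢y⇒x∈⊤-y y≢u)

module CutVertex {H K : Graph n} (compl : Complementary H K) (4<n : 4 < n)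
  (H-conn : ConnectedOn H ⊤) (K-conn : ConnectedOn K ⊤)
  {v x y : Fin n} (x≢v : x ≢ v) (y≢v : y ≢ v) (¬x⇝y : ¬ Walk H (⊤ - v) x y) where

  C : Subset n
  C = component H (⊤ - v) x

  D : Pred (Fin n) 0ℓ
  D d = d ≢ v × d ∉ C

  x∈C : x ∈ C
  x∈C = ∈-component⁺ ε

  y∈D : D y
  y∈D = y≢v , ¬x⇝y ∘ ∈-component⁻

  SidesSurvive : Fin n → Set
  SidesSurvive u = (∃ λ c → c ∈ C × c ≢ u) × (∃ λ d → D d × d ≢ u)

  ∈C⇒≢v : ∀ {c} → c ∈ C → c ≢ v
  ∈C⇒≢v c∈C = x∈p-y⇒x≢y (walk-∈ (x≢y⇒x∈⊤-y x≢v) (∈-component⁻ c∈C))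

  across-edge : ∀ {c d} → c ∈ C → D d → Edge K c d
  across-edge c∈C (d≢v , d∉C) = complementary-edge⁺ compl (x∈p∧y∉p⇒x≢y c∈C d∉C) λ e →
    d∉C (∈-component⁺ (∈-component⁻ c∈C ◅◅ edge⇒walk-avoiding (∈C⇒≢v c∈C) d≢v e))

  K-connected : ∀ {u} → SidesSurvive u → (∃ λ w → Edge K v w × w ≢ u) → ConnectedOn K (⊤ - u)
  K-connected {u} ((c , c∈C , c≢u) , (d , d∈D , d≢u)) (w , vw , w≢u) = hub⇒connectedOn c to-c
    where
    to-c′ : ∀ {t} → t ≢ v → t ≢ u → Walk K (⊤ - u) t c
    to-c′ {t} t≢v t≢u with t ∈? C
    ... | yes t∈C = edge⇒walk-avoiding t≢u d≢u (across-edge t∈C d∈D)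
                 ◅◅ edge⇒walk-avoiding d≢u c≢u (edge-sym K (across-edge c∈C d∈D))
    ... | no  t∉C = edge⇒walk-avoiding t≢u c≢u (edge-sym K (across-edge c∈C (t≢v , t∉C)))
    to-c : ∀ t → t ∈ ⊤ - u → Walk K (⊤ - u) t c
    to-c t t∈⊤-u with t ≟ v
    ... | yes refl = edge⇒walk-avoiding (x∈p-y⇒x≢y t∈⊤-u) w≢u vw ◅◅ to-c′ (≢-sym (edge⇒≢ K vw)) w≢u
    ... | no  t≢v  = to-c′ t≢v (x∈p-y⇒x≢y t∈⊤-u)

  two-K-neighbours : ∀ {w₁ w₂} → Edge K v w₁ → Edge K v w₂ → w₁ ≢ w₂ → ∃ (Deletable H K)
  two-K-neighbours vw₁ vw₂ w₁≢w₂ with ∃-≢-all (v ∷ x ∷ y ∷ []) (<-trans ≤-refl 4<n)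
  ... | e , v≢e ∷ x≢e ∷ y≢e ∷ [] with component-nonCut H-conn ∈⊤ (x≢y⇒x∈⊤-y (≢-sym v≢e))
  ... | u , u∈Cₑ , H-u = u , H-u , K-connected sides (∃-≢-of-two w₁≢w₂ vw₁ vw₂ u)
    where
    e⇝u : Walk H (⊤ - v) e u
    e⇝u = ∈-component⁻ u∈Cₑ
    sides : SidesSurvive u
    sides with e ∈? C
    ... | yes e∈C = ∃-≢-of-two x≢e x∈C e∈C u , y , y∈D , x∈p∧y∉p⇒x≢y u∈C (proj₂ y∈D) ∘ sym
      where
      u∈C : u ∈ C
      u∈C = ∈-component⁺ (∈-component⁻ e∈C ◅◅ e⇝u)
    ... | no  e∉C = (x , x∈C , x∈p∧y∉p⇒x≢y x∈C u∉C) , ∃-≢-of-two y≢e y∈D (≢-sym v≢e , e∉C) u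
      where
      u∉C : u ∉ C
      u∉C u∈C = e∉C (∈-component⁺ (∈-component⁻ u∈C ◅◅ walk-sym e⇝u))

  module OneKNeighbour {w z} (vw : Edge K v w) (unique : ∀ {t} → Edge K v t → t ≡ w)
                        (wz : Edge H w z) where

    H-edge-to-v : ∀ {t} → t ≢ v → t ≢ w → Edge H t v
    H-edge-to-v t≢v t≢w =
      edge-sym H (complementary-edge⁺ (complementary-sym compl) (≢-sym t≢v) (t≢w ∘ unique))

    z≢v : z ≢ v
    z≢v refl = complementary-edge⁻ compl vw (edge-sym H wz)

    H-connected : ∀ {u} → v ≢ u → w ≢ u → z ≢ u → ConnectedOn H (⊤ - u)
    H-connected {u} v≢u w≢u z≢u = hub⇒connectedOn v to-v
      where
      to-v : ∀ t → t ∈ ⊤ - u → Walk H (⊤ - u) t v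
      to-v t t∈⊤-u with t ≟ v | t ≟ w
      ... | yes refl | _        = ε
      ... | no  t≢v  | yes refl =
        edge⇒walk-avoiding w≢u z≢u wz ◅◅ edge⇒walk-avoiding z≢u v≢u (H-edge-to-v z≢v (≢-sym (edge⇒≢ H wz)))
      ... | no  t≢v  | no  t≢w  = edge⇒walk-avoiding (x∈p-y⇒x≢y t∈⊤-u) v≢u (H-edge-to-v t≢v t≢w)

    deletable-avoiding : ∀ o → (∀ {u} → w ≢ u → o ≢ u → SidesSurvive u) → ∃ (Deletable H K)
    deletable-avoiding o sides with ∃-≢-all (v ∷ w ∷ z ∷ o ∷ []) 4<n
    ... | u , v≢u ∷ w≢u ∷ z≢u ∷ o≢u ∷ [] =
      u , H-connected v≢u w≢u z≢u , K-connected (sides w≢u o≢u) (w , vw , w≢u)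

    deletable : ∃ (Deletable H K)
    deletable with w ∈? C
    ... | yes w∈C = deletable-avoiding y λ w≢u y≢u → (w , w∈C , w≢u) , (y , y∈D , y≢u)
    ... | no  w∉C = deletable-avoiding x λ w≢u x≢u → (x , x∈C , x≢u) , (w , w∈D , w≢u)
      where
      w∈D : D w
      w∈D = ≢-sym (edge⇒≢ K vw) , w∉C

  one-K-neighbour : ∀ {w} → Edge K v w → (∀ {t} → Edge K v t → t ≡ w) → ∃ (Deletable H K)
  one-K-neighbour vw unique =
    let _ , wz = ∃-neighbour H-conn (≢-sym (edge⇒≢ K vw)) in OneKNeighbour.deletable vw unique wz

  deletable : ∃ (Deletable H K)
  deletable with ∃-neighbour K-conn (≢-sym x≢v)
  ... | w , vw with any? (λ t → (adj K v t Bool.≟ true) ×-dec ¬? (t ≟ w))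
  ...   | yes (w′ , vw′ , w′≢w) = two-K-neighbours vw′ vw w′≢w
  ...   | no  ¬second = one-K-neighbour vw λ {t} vt →
    decidable-stable (t ≟ w) λ t≢w → ¬second (t , vt , t≢w)

cutVertex⇒deletable : ∀ {H K : Graph n} {v} → Complementary H K → 4 < n →
                      ConnectedOn H ⊤ → ConnectedOn K ⊤ → ¬ ConnectedOn H (⊤ - v) → ∃ (Deletable H K)
cutVertex⇒deletable {v = v} compl 4<n H-conn K-conn ¬H-v
  with ∃-≢-all (v ∷ []) (<-trans (s≤s (s≤s z≤n)) 4<n)
... | x , v≢x ∷ [] with ¬connectedOn⇒unreachable ¬H-v x
... | y , y∈⊤-v , ¬x⇝y =
  CutVertex.deletable compl 4<n H-conn K-conn (≢-sym v≢x) (x∈p-y⇒x≢y y∈⊤-v) ¬x⇝y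

∃-deletable : ∀ {H K : Graph n} → Complementary H K → 4 < n →
              ConnectedOn H ⊤ → ConnectedOn K ⊤ → ∃ (Deletable H K)
∃-deletable {H = H} {K} compl 4<n@(s≤s _) H-conn K-conn
  with connectedOn? {G = H} {⊤ - zero} | connectedOn? {G = K} {⊤ - zero}
... | yes H-0 | yes K-0 = zero , H-0 , K-0
... | no ¬H-0 | _       = cutVertex⇒deletable {v = zero} compl 4<n H-conn K-conn ¬H-0
... | yes _   | no ¬K-0 =
  map₂ swap (cutVertex⇒deletable {v = zero} (complementary-sym compl) 4<n K-conn H-conn ¬K-0)

connected⇒connectedOn-⊤ : ∀ {G : Graph n} → Connected G → ConnectedOn G ⊤
connected⇒connectedOn-⊤ conn u v _ _ = gmap id (edgeIn ∈⊤ ∈⊤) (conn u v)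

module _ {n} (v : Fin (suc n)) where

  connectedOn-⊤-⇒connected : (G : Graph (suc n)) (G′ : Graph n) →
                             (∀ {x y} → Edge G (punchIn v x) (punchIn v y) → Edge G′ x y) →
                             ConnectedOn G (⊤ - v) → Connected G′
  connectedOn-⊤-⇒connected G G′ edge-down conn x y =
    lower (conn (punchIn v x) (punchIn v y) (punchIn∈ x) (punchIn∈ y)) refl refl
    where
    punchIn∈ : ∀ x → punchIn v x ∈ ⊤ - v
    punchIn∈ x = x≢y⇒x∈⊤-y (punchInᵢ≢i v x)
    lower : ∀ {a b x y} → Walk G (⊤ - v) a b → punchIn v x ≡ a → punchIn v y ≡ b → Star (Edge G′) x y
    lower {x = x} {y} ε refl eq = subst (Star _ x) (punchIn-injective v x y (sym eq)) ε
    lower (_◅_ {j = s} (edgeIn _ s∈ e) w) refl eq =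
      edge-down (subst (Edge G _) (sym s≡) e) ◅ lower w s≡ eq
      where
      v≢s : v ≢ s
      v≢s = ≢-sym (x∈p-y⇒x≢y s∈)
      s≡ : punchIn v (punchOut v≢s) ≡ s
      s≡ = punchIn-punchOut v≢s

  deletable⇒complementConnected : (G : Graph (suc n)) → Deletable G (complement G) v →
                                  ComplementConnected (deleteVertex G v)
  deletable⇒complementConnected G (G-v , Ḡ-v) =
    connectedOn-⊤-⇒connected G (deleteVertex G v) id G-v ,
    connectedOn-⊤-⇒connected (complement G) (complement (deleteVertex G v)) complement-edge-down Ḡ-v
    where
    open ≡-Reasoning
    complement-edge-down : ∀ {x y} → Edge (complement G) (punchIn v x) (punchIn v y) →
                           Edge (complement (deleteVertex G v)) x y
    complement-edge-down {x} {y} e = begin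
      adj (complement (deleteVertex G v)) x y        ≡⟨ complement-adj (deleteVertex G v) x≢y ⟩
      not (adj G (punchIn v x) (punchIn v y))        ≡⟨ complement-adj G x′≢y′ ⟨
      adj (complement G) (punchIn v x) (punchIn v y) ≡⟨ e ⟩
      true                                           ∎
      where
      x′≢y′ : punchIn v x ≢ punchIn v y
      x′≢y′ = edge⇒≢ (complement G) e
      x≢y : x ≢ y
      x≢y = x′≢y′ ∘ cong (punchIn v)

lemma3 : ∀ (n : ℕ) → 4 ≤ n → (G : Graph (suc n)) → ComplementConnected G →
    ∃ λ (v : Fin (suc n)) → ComplementConnected (deleteVertex G v)
lemma3 n 4≤n G (G-conn , Ḡ-conn) =
  let v , deletable = ∃-deletable (mkComplementary (complement-adj G)) (s≤s 4≤n)
                        (connected⇒connectedOn-⊤ G-conn) (connected⇒connectedOn-⊤ Ḡ-conn)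
  in v , deletable⇒complementConnected v G deletable
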